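{- Let $G=(V,E)$ be a finite digraph, $n\ge 1$, $S=\{1,\dots,n\}$, and let $l_1,\dots,l_n$ be integers with $l_i\ge 1$. Let $P$ be the product poset $[0,l_1]\times\cdots\times[0,l_n]$ of integer intervals, with $(x_1,\dots,x_n)\le(y_1,\dots,y_n)$ iff $x_i\le y_i$ for all $i$. Then there exists a map $d:E\to S$ such that, for every $i$, no walk of length $l_i+1$ has all of its edges colored $i$ by $d$, if and only if the vertices of $G$ are $P$-colorable.
   Context: A digraph has finite vertex set and edges that are ordered pairs of distinct vertices; write $u\to v$ for an edge. A walk of length $L$ is a sequence $(v_1\dots v_{L+1})$ with $v_1\to\dots\to v_{L+1}$; its edges are $(v_j,v_{j+1})$. A $P$-coloring of the vertices is a map $c:V\to P$ with $c(u)\not\le c(v)$ whenever $u\to v$. -}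

module Defs where

open import Data.Nat using (ℕ; zero; suc; _≤_)
open import Data.Fin using (Fin; toℕ)
open import Data.Bool using (Bool; true)
open import Data.Vec using (Vec; []; _∷_)
open import Data.Product using (Σ; _×_; ∃-syntax)
open import Data.Unit using (⊤)
open import Relation.Binary.PropositionalEquality using (_≡_)
open import Relation.Nullary using (¬_)

record Digraph : Set where
  field
    m     : ℕ
    adj   : Fin m → Fin m → Bool
    loopless : ∀ u → ¬ (adj u u ≡ true)

open Digraph public

Edge : (G : Digraph) → Set
Edge G = Σ (Fin (m G)) λ u → Σ (Fin (m G)) λ v → adj G u v ≡ true

-- Edge coloring d : E → Fin n.  Since adj-proofs are proofs of an equality
-- in Bool (a set), the edge is determined by (u , v).
EdgeColoring : Digraph → ℕ → Set
EdgeColoring G n = (u v : Fin (m G)) → adj G u v ≡ true → Fin n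

AllEdgesColored : ∀ (G : Digraph) {n k} → EdgeColoring G n → Fin n →
                  Vec (Fin (m G)) k → Set
AllEdgesColored G d i [] = ⊤
AllEdgesColored G d i (v ∷ []) = ⊤
AllEdgesColored G d i (u ∷ v ∷ vs) =
  Σ (adj G u v ≡ true) (λ e → d u v e ≡ i) × AllEdgesColored G d i (v ∷ vs)

MonoWalk : ∀ (G : Digraph) {n} → EdgeColoring G n → Fin n → ℕ → Set
MonoWalk G d i L = Σ (Vec (Fin (m G)) (suc L)) (AllEdgesColored G d i)

P : ∀ {n} → (Fin n → ℕ) → Set
P {n} l = (i : Fin n) → Fin (suc (l i))

_≤P_ : ∀ {n} {l : Fin n → ℕ} → P l → P l → Set
_≤P_ {n} x y = (i : Fin n) → toℕ (x i) ≤ toℕ (y i)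

IsPColoring : ∀ (G : Digraph) {n} (l : Fin n → ℕ) → (Fin (m G) → P l) → Set
IsPColoring G l c = ∀ u v → adj G u v ≡ true → ¬ (c u ≤P c v)

PColorable : ∀ (G : Digraph) {n} (l : Fin n → ℕ) → Set
PColorable G l = ∃[ c ] IsPColoring G l c

{-# OPTIONS --safe #-}
-- An edge colouring without long monochromatic walks yields a P-colouring by
-- sending u to the vector whose i-th entry is the length of a longest walk of
-- colour i starting at u: along an edge u → v of colour i that length drops
-- strictly, so c(u) ≰ c(v).  Conversely, for a P-colouring c each edge u → v has
-- a coordinate i with c(v)ᵢ < c(u)ᵢ; colouring the edge by it, the i-th coordinate
-- strictly decreases along every walk of colour i, which therefore has length
-- at most lᵢ.
module Submission where

open import Defs
open import Data.Nat using (ℕ; zero; suc; _≤_; _<_; _≤?_; z≤n; s≤s; s≤s⁻¹)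
open import Data.Nat.Properties using (≤-refl; ≤-trans; m≤n⇒m≤1+n; ≰⇒>; <⇒≱; m≤n⇒m<n∨m≡n)
open import Data.Fin using (Fin; toℕ; fromℕ<)
import Data.Fin as Fin
open import Data.Fin.Properties using (any?; ¬∀⟶∃¬; toℕ<n; toℕ-fromℕ<)
open import Data.Bool using (true)
import Data.Bool as Bool
open import Data.Vec using (Vec; []; _∷_)
open import Data.Product using (Σ; ∃; ∃-syntax; _×_; _,_; proj₁; proj₂; uncurry)
import Data.Product as Product
open import Data.Sum using (inj₁; inj₂)
open import Data.Empty using (⊥-elim)
open import Data.Unit using (tt)
open import Level using (_⊔_; 0ℓ)
open import Function using (_∘_; id)
open import Function.Bundles using (_⇔_; mk⇔; module Equivalence)
open import Relation.Binary using (Rel; Decidable)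
open import Relation.Binary.PropositionalEquality using (_≡_; refl; subst; subst₂)
open import Relation.Nullary using (¬_; Dec; yes; no; _×-dec_)
open import Relation.Nullary.Decidable using (map′)
open import Axiom.UniquenessOfIdentityProofs using (module Decidable⇒UIP)

data Walk {a ℓ} {A : Set a} (R : Rel A ℓ) : ℕ → A → Set (a ⊔ ℓ) where
  []  : ∀ {u} → Walk R zero u
  _∷_ : ∀ {k u v} → R u v → Walk R k v → Walk R (suc k) u

walk-length≤height : ∀ {a ℓ} {A : Set a} {R : Rel A ℓ} (h : A → ℕ) →
                     (∀ {u v} → R u v → h v < h u) →
                     ∀ {k u} → Walk R k u → k ≤ h u
walk-length≤height h descends []      = z≤n
walk-length≤height h descends (r ∷ w) = ≤-trans (s≤s (walk-length≤height h descends w)) (descends r)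

module LongestWalk {ℓ} {m : ℕ} {R : Rel (Fin m) ℓ} (R? : Decidable R) where

  walk? : ∀ k u → Dec (Walk R k u)
  walk? zero    u = yes []
  walk? (suc k) u = map′ (λ (_ , r , w) → r ∷ w) uncons (any? λ v → R? u v ×-dec walk? k v)
    where
    uncons : Walk R (suc k) u → ∃ λ v → R u v × Walk R k v
    uncons (r ∷ w) = _ , r , w

  maxWalkLength : ℕ → Fin m → ℕ
  maxWalkLength zero    u = zero
  maxWalkLength (suc k) u with walk? (suc k) u
  ... | yes _ = suc k
  ... | no  _ = maxWalkLength k u

  maxWalkLength≤ : ∀ k u → maxWalkLength k u ≤ k
  maxWalkLength≤ zero    u = z≤n
  maxWalkLength≤ (suc k) u with walk? (suc k) u
  ... | yes _ = ≤-refl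
  ... | no  _ = m≤n⇒m≤1+n (maxWalkLength≤ k u)

  maxWalkLength-walk : ∀ k u → Walk R (maxWalkLength k u) u
  maxWalkLength-walk zero    u = []
  maxWalkLength-walk (suc k) u with walk? (suc k) u
  ... | yes w = w
  ... | no  _ = maxWalkLength-walk k u

  walk⇒≤maxWalkLength : ∀ {j} k {u} → Walk R j u → j ≤ k → j ≤ maxWalkLength k u
  walk⇒≤maxWalkLength zero    _ z≤n = z≤n
  walk⇒≤maxWalkLength (suc k) {u} w j≤1+k with walk? (suc k) u
  ... | yes _ = j≤1+k
  ... | no ¬w with m≤n⇒m<n∨m≡n j≤1+k
  ...   | inj₁ j<1+k = walk⇒≤maxWalkLength k w (s≤s⁻¹ j<1+k)
  ...   | inj₂ refl  = ⊥-elim (¬w w)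

  -- Prepending r to a longest walk from v gives a walk from u one step longer,
  -- which still respects the cap k because no walk has length 1 + k.
  maxWalkLength-decreasing : ∀ {k} → (∀ u → ¬ Walk R (suc k) u) →
                             ∀ {u v} → R u v → maxWalkLength k v < maxWalkLength k u
  maxWalkLength-decreasing {k} noLongWalk {u} {v} r = walk⇒≤maxWalkLength k extended belowCap
    where
    extended : Walk R (suc (maxWalkLength k v)) u
    extended = r ∷ maxWalkLength-walk k v

    belowCap : maxWalkLength k v < k
    belowCap with m≤n⇒m<n∨m≡n (maxWalkLength≤ k v)
    ... | inj₁ lt = lt
    ... | inj₂ eq = ⊥-elim (noLongWalk u (subst (λ j → Walk R (suc j) u) eq extended))

≰P⇒∃> : ∀ {n} {l : Fin n → ℕ} {x y : P l} → ¬ (x ≤P y) → ∃ λ i → toℕ (y i) < toℕ (x i)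
≰P⇒∃> {n} {x = x} {y} x≰y =
  Product.map₂ ≰⇒> (¬∀⟶∃¬ n _ (λ i → toℕ (x i) ≤? toℕ (y i)) x≰y)

module _ (G : Digraph) {n : ℕ} (d : EdgeColoring G n) where

  ColoredEdge : Fin n → Rel (Fin (m G)) 0ℓ
  ColoredEdge i u v = Σ (adj G u v ≡ true) λ e → d u v e ≡ i

  coloredEdge? : ∀ i → Decidable (ColoredEdge i)
  coloredEdge? i u v with adj G u v Bool.≟ true
  ... | no  ¬e = no (¬e ∘ proj₁)
  ... | yes e with d u v e Fin.≟ i
  ...   | yes de≡i = yes (e , de≡i)
  ...   | no  de≢i = no λ (e′ , de′≡i) →
            de≢i (subst (λ e → d u v e ≡ i) (Decidable⇒UIP.≡-irrelevant Bool._≟_ e′ e) de′≡i)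

  monoWalk⇔walk : ∀ i L → MonoWalk G d i L ⇔ ∃ (Walk (ColoredEdge i) L)
  monoWalk⇔walk i L = mk⇔ to (λ (u , w) → Product.map (u ∷_) id (fromWalk w))
    where
    toWalk : ∀ {k u} (vs : Vec (Fin (m G)) k) →
             AllEdgesColored G d i (u ∷ vs) → Walk (ColoredEdge i) k u
    toWalk []       _        = []
    toWalk (v ∷ vs) (uv , a) = uv ∷ toWalk vs a

    to : MonoWalk G d i L → ∃ (Walk (ColoredEdge i) L)
    to (u ∷ vs , a) = u , toWalk vs a

    fromWalk : ∀ {k u} → Walk (ColoredEdge i) k u →
               Σ (Vec (Fin (m G)) k) λ vs → AllEdgesColored G d i (u ∷ vs)
    fromWalk []       = [] , tt
    fromWalk (uv ∷ w) = Product.map (_ ∷_) (uv ,_) (fromWalk w)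

module _ (G : Digraph) {n : ℕ} (l : Fin n → ℕ) where

  noLongMonoWalk⇒PColorable : (d : EdgeColoring G n) →
                              (∀ i → ¬ MonoWalk G d i (suc (l i))) → PColorable G l
  noLongMonoWalk⇒PColorable d noLongMonoWalk = c , isPColoring
    where
    open LongestWalk using (maxWalkLength; maxWalkLength≤; maxWalkLength-decreasing)

    height : Fin n → Fin (m G) → ℕ
    height i = maxWalkLength (coloredEdge? G d i) (l i)

    c : Fin (m G) → P l
    c u i = fromℕ< (s≤s (maxWalkLength≤ (coloredEdge? G d i) (l i) u))

    height-decreasing : ∀ {i u v} → ColoredEdge G d i u v → height i v < height i u
    height-decreasing {i} = maxWalkLength-decreasing (coloredEdge? G d i)
      λ u w → noLongMonoWalk i (Equivalence.from (monoWalk⇔walk G d i (suc (l i))) (u , w))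

    isPColoring : IsPColoring G l c
    isPColoring u v e c[u]≤c[v] =
      <⇒≱ (height-decreasing (e , refl))
          (subst₂ _≤_ (toℕ-fromℕ< _) (toℕ-fromℕ< _) (c[u]≤c[v] (d u v e)))

  PColorable⇒noLongMonoWalk : PColorable G l → ∃[ d ] (∀ i → ¬ MonoWalk G d i (suc (l i)))
  PColorable⇒noLongMonoWalk (c , isPColoring) = d , noLongMonoWalk
    where
    descent : ∀ {u v} → adj G u v ≡ true → ∃ λ i → toℕ (c v i) < toℕ (c u i)
    descent e = ≰P⇒∃> (isPColoring _ _ e)

    d : EdgeColoring G n
    d u v e = proj₁ (descent e)

    coordinate-decreasing : ∀ {i u v} → ColoredEdge G d i u v → toℕ (c v i) < toℕ (c u i)
    coordinate-decreasing (e , refl) = proj₂ (descent e)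

    noLongMonoWalk : ∀ i → ¬ MonoWalk G d i (suc (l i))
    noLongMonoWalk i mono with Equivalence.to (monoWalk⇔walk G d i (suc (l i))) mono
    ... | u , w = <⇒≱ (toℕ<n (c u i))
                      (walk-length≤height (λ u → toℕ (c u i)) coordinate-decreasing w)

mainTheorem4 : (G : Digraph) (n : ℕ) → 1 ≤ n → (l : Fin n → ℕ) → (∀ i → 1 ≤ l i) →
    (∃[ d ] (∀ (i : Fin n) → ¬ MonoWalk G d i (suc (l i)))) ⇔ PColorable G l
mainTheorem4 G n _ l _ =
  mk⇔ (uncurry (noLongMonoWalk⇒PColorable G l)) (PColorable⇒noLongMonoWalk G l)
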